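{- Let $A\vdash[n]$ and $B\vdash[m]$. For every $S\in\binom{[n+m]}{n}$, $$\ell\big((A\!\uparrow_S\cup B\!\uparrow_{S^c})^!\big)\le \ell(A^!)+\ell(B^!),$$ with equality if and only if $(A\!\uparrow_S\cup B\!\uparrow_{S^c})^!\in A^!\sqcup\!\sqcup B^!$.
   Context: A set partition $A\vdash[n]$ is a set of nonempty pairwise disjoint subsets (parts) of $[n]$ with union $[n]$. For $A\vdash[n]$, $B\vdash[k]$, $A|B\vdash[n+k]$ consists of the parts of $A$ together with the parts of $B$ shifted by $n$. $A$ is atomic if $n\ge1$ and $A\ne B|C$ with $B\vdash[j]$, $C\vdash[n-j]$, $0<j<n$. Each $A$ factors uniquely as $A=A^{(1)}|\cdots|A^{(d)}$ with all $A^{(j)}$ atomic; $A^!=(A^{(1)},\dots,A^{(d)})$, regarded as a word in the alphabet of atomic set partitions, and $\ell(A^!)=d$. $\binom{[n+m]}{n}$ is the set of $n$-element subsets of $[n+m]$, and $S^c=[n+m]\setminus S$. For $A\vdash[n]$ and an $n$-element set $S$ of integers, $A\!\uparrow_S$ is obtained by replacing each entry by its image under the unique order-preserving bijection $[n]\to S$; so $A\!\uparrow_S\cup B\!\uparrow_{S^c}\vdash[n+m]$. For words $u,v$, $u\sqcup\!\sqcup v$ is the multiset of all shuffles of $u$ and $v$. -}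

module Defs where

open import Data.Nat using (ℕ; zero; suc; _+_; _∸_; _<_; _≤_; _≤?_)
open import Data.Nat.Properties using (≤-refl)
open import Data.Bool using (Bool; true; false)
open import Data.List using (List; []; _∷_; _++_; map; concat; upTo; merge; length)
open import Data.List.Relation.Unary.All using (All)
open import Data.List.Relation.Unary.Linked using (Linked)
open import Data.List.Relation.Binary.Permutation.Propositional using (_↭_)
open import Data.Vec using (Vec; []; _∷_)
open import Data.Fin.Subset using (Subset)
open import Data.Product using (Σ; ∃; _×_)
open import Relation.Binary.PropositionalEquality using (_≡_)
open import Relation.Nullary using (¬_)

-- A part (a finite set of positive integers) is represented canonically by
-- its strictly increasing list of elements.  A set partition is represented
-- canonically by the list of its parts ordered by their minima.
Part : Set
Part = List ℕ

RawPartition : Set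
RawPartition = List Part

minOf : Part → ℕ
minOf []      = 0
minOf (x ∷ _) = x

NonEmpty : Part → Set
NonEmpty p = 1 ≤ length p

range : ℕ → List ℕ
range n = map suc (upTo n)

IsSetPartition : ℕ → RawPartition → Set
IsSetPartition n P =
  All NonEmpty P ×
  All (Linked _<_) P ×
  Linked (λ p q → minOf p < minOf q) P ×
  (concat P ↭ range n)

shift : ℕ → RawPartition → RawPartition
shift k = map (map (k +_))

bar : ℕ → RawPartition → RawPartition → RawPartition
bar n A B = A ++ shift n B

Atomic : ℕ → RawPartition → Set
Atomic n A =
  IsSetPartition n A × 1 ≤ n ×
  ¬ (Σ ℕ λ j → Σ RawPartition λ B → Σ RawPartition λ C →
       0 < j × j < n × IsSetPartition j B × IsSetPartition (n ∸ j) C ×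
       A ≡ bar j B C)

-- Factorization n A w : w = (A⁽¹⁾,…,A⁽ᵈ⁾) is a factorization of A ⊢ [n]
-- into atomic set partitions, A = A⁽¹⁾|⋯|A⁽ᵈ⁾.  By uniqueness, w = A^!.
data Factorization : ℕ → RawPartition → List RawPartition → Set where
  []  : Factorization 0 [] []
  _∷_ : ∀ {k m Q R w} → Atomic k Q → Factorization m R w →
        Factorization (k + m) (bar k Q R) (Q ∷ w)

-- elements (1-based, increasing) of a subset of [k]
elems : ∀ {k} → Subset k → List ℕ
elems []           = []
elems (true ∷ s)   = 1 ∷ map suc (elems s)
elems (false ∷ s)  = map suc (elems s)

-- image of x ∈ [n] under the order-preserving bijection [n] → S,
-- where S is given as its increasing list of elements
relabel : List ℕ → ℕ → ℕ
relabel []       _             = 0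
relabel (s ∷ ss) zero          = 0
relabel (s ∷ ss) (suc zero)    = s
relabel (s ∷ ss) (suc (suc x)) = relabel ss (suc x)

lift : ∀ {k} → RawPartition → Subset k → RawPartition
lift A S = map (map (relabel (elems S))) A

union : RawPartition → RawPartition → RawPartition
union = merge (λ p q → minOf p ≤? minOf q)

shuffles : {X : Set} → List X → List X → List (List X)
shuffles []       v        = v ∷ []
shuffles (x ∷ u)  []       = (x ∷ u) ∷ []
shuffles (x ∷ u)  (y ∷ v)  = map (x ∷_) (shuffles u (y ∷ v)) ++ map (y ∷_) (shuffles (x ∷ u) v)

-- Let C = A↑S ∪ B↑Sᶜ, let Q ⊢ [k] be the first atomic factor of C, and split S = S₁S₂ at k.
-- No part of C crosses k and relabelling is order preserving, so no part of A crosses |S₁| and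
-- no part of B crosses |S₁ᶜ|.  A partition can only be cut between its atomic factors, hence
-- A^! = u₁u₂ and B^! = v₁v₂, where Q is the union of the lifts (along S₁, S₁ᶜ) of the partitions
-- with factorizations u₁, v₁, and the rest of C is built in the same way from u₂, v₂.  Since Q is
-- nonempty, |u₁| + |v₁| ≥ 1, and induction gives ℓ(C^!) ≤ ℓ(A^!) + ℓ(B^!).  Equality forces
-- |u₁| + |v₁| = 1, i.e. Q is the first letter of A^! or of B^!, and inductively C^! is a shuffle.
module Submission where

open import Defs
open import Data.Nat using (ℕ; zero; suc; _+_; _∸_; _≤_; _<_; _≤?_; _≤ᵇ_; z≤n; s≤s)
open import Data.Nat.Properties
open import Data.Bool using (true; false; not)
open import Data.List using (List; []; _∷_; _++_; map; concat; length; upTo; applyUpTo; filter)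
open import Data.List.Properties
  using (map-∘; map-++; map-cong; map-id; map-id-local; map-cong-local; map-injective; map-upTo;
         length-map; length-++; concat-++; concat-map; ++-identityʳ; ++-assoc; ∷-injective;
         filter-++; filter-all; filter-none)
open import Data.List.Relation.Unary.All as All using (All; []; _∷_)
open import Data.List.Relation.Unary.All.Properties as All using (++⁺; ++⁻; ++⁻ˡ; ++⁻ʳ; concat⁻; concat⁺; applyUpTo⁺₁)
open import Data.List.Relation.Unary.Linked as Linked using (Linked; []; [-]; _∷_)
open import Data.List.Relation.Unary.Linked.Properties as Linked using (Linked⇒AllPairs)
import Data.List.Relation.Unary.AllPairs as AllPairs
open import Data.List.Relation.Binary.Permutation.Propositional using (_↭_; ↭-sym)
open import Data.List.Relation.Binary.Permutation.Propositional.Properties using (All-resp-↭; filter-↭; merge-↭)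
import Data.List.Relation.Binary.Permutation.Propositional.Properties as ↭
open import Data.Vec using ([]; _∷_; splitAt) renaming (_++_ to _++ᵛ_)
import Data.Vec.Properties as Vec
open import Data.Fin.Subset using (Subset; ∁; ∣_∣; ⊤)
open import Data.Fin.Subset.Properties using (∣∁p∣≡n∸∣p∣; ∣p∣≤n; ∣p∣≡n⇒p≡⊤; ∣⊤∣≡n)
open import Data.Product using (Σ; ∃₂; _×_; _,_; proj₁; proj₂)
import Data.Product as Product
open import Data.Sum using (_⊎_; inj₁; inj₂; [_,_]′)
open import Data.List.Membership.Propositional using (_∈_)
open import Data.List.Membership.Propositional.Properties using (∈-++⁻; ∈-++⁺ˡ; ∈-++⁺ʳ; ∈-map⁺; ∈-map⁻)
open import Data.List.Relation.Unary.Any using (here)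
open import Algebra.Properties.CommutativeSemigroup +-commutativeSemigroup using (interchange)
open import Function using (_∘_)
open import Function.Bundles using (_⇔_; mk⇔)
open import Relation.Binary.PropositionalEquality using (_≡_; refl; sym; trans; cong; cong₂; subst; subst₂; module ≡-Reasoning)
open import Relation.Nullary using (¬_; yes; no)
open import Relation.Nullary.Negation using (contradiction)
open import Relation.Unary using (Decidable)
import Relation.Nullary.Decidable as Dec
open import Relation.Nullary.Decidable using (toSum)

InRange : ℕ → ℕ → Set
InRange n x = 1 ≤ x × x ≤ n

EntriesIn : ℕ → RawPartition → Set
EntriesIn n = All (All (InRange n))

MinsIn MinsAtMost MinsAbove : ℕ → RawPartition → Set
MinsIn n = All (InRange n ∘ minOf)
MinsAtMost k = All (λ p → minOf p ≤ k)
MinsAbove k = All (λ p → k < minOf p)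

MinsIn⇒MinsAtMost : ∀ {n P} → MinsIn n P → MinsAtMost n P
MinsIn⇒MinsAtMost = All.map proj₂

MinsIn⇒MinsAbove0 : ∀ {n P} → MinsIn n P → MinsAbove 0 P
MinsIn⇒MinsAbove0 = All.map proj₁

PartBelowOrAbove : ℕ → Part → Set
PartBelowOrAbove i p = All (_≤ i) p ⊎ All (i <_) p

NoPartCrosses : ℕ → RawPartition → Set
NoPartCrosses i = All (PartBelowOrAbove i)

_<ᵐ_ : Part → Part → Set
p <ᵐ q = minOf p < minOf q

-- IsSetPartition n is IsPartitionOf (range n), definitionally.
IsPartitionOf : List ℕ → RawPartition → Set
IsPartitionOf xs P = All NonEmpty P × All (Linked _<_) P × Linked _<ᵐ_ P × (concat P ↭ xs)

applyUpTo-+ : ∀ {A : Set} (f : ℕ → A) m n → applyUpTo f (m + n) ≡ applyUpTo f m ++ applyUpTo (f ∘ (m +_)) n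
applyUpTo-+ f zero    n = refl
applyUpTo-+ f (suc m) n = cong (f 0 ∷_) (applyUpTo-+ (f ∘ suc) m n)

range-+ : ∀ m n → range (m + n) ≡ range m ++ map (m +_) (range n)
range-+ m n = begin
  map suc (upTo (m + n))                         ≡⟨ map-upTo suc (m + n) ⟩
  applyUpTo suc (m + n)                          ≡⟨ applyUpTo-+ suc m n ⟩
  applyUpTo suc m ++ applyUpTo (suc ∘ (m +_)) n  ≡⟨ cong₂ _++_ (sym (map-upTo suc m)) (sym (map-upTo _ n)) ⟩
  range m ++ map (suc ∘ (m +_)) (upTo n)         ≡⟨ cong (range m ++_) (map-cong (λ x → sym (+-suc m x)) (upTo n)) ⟩
  range m ++ map ((m +_) ∘ suc) (upTo n)         ≡⟨ cong (range m ++_) (map-∘ (upTo n)) ⟩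
  range m ++ map (m +_) (range n)                ∎
  where open ≡-Reasoning

range-InRange : ∀ n → All (InRange n) (range n)
range-InRange n = All.map⁺ (applyUpTo⁺₁ _ n (λ i<n → s≤s z≤n , i<n))

↭-split : ∀ {A : Set} {P : A → Set} (P? : Decidable P) {xs ys us vs : List A} →
  All P xs → All (¬_ ∘ P) ys → All P us → All (¬_ ∘ P) vs →
  xs ++ ys ↭ us ++ vs → xs ↭ us × ys ↭ vs
↭-split {P = P} P? Pxs ¬Pys Pus ¬Pvs xsys↭usvs =
  subst₂ _↭_ (keep Pxs ¬Pys) (keep Pus ¬Pvs) (filter-↭ P? xsys↭usvs) ,
  subst₂ _↭_ (drop Pxs ¬Pys) (drop Pus ¬Pvs) (filter-↭ ¬P? xsys↭usvs)
  where
  ¬P? = Dec.¬? ∘ P?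
  keep : ∀ {as bs} → All P as → All (¬_ ∘ P) bs → filter P? (as ++ bs) ≡ as
  keep {as} {bs} Pas ¬Pbs = begin
    filter P? (as ++ bs)            ≡⟨ filter-++ P? as bs ⟩
    filter P? as ++ filter P? bs    ≡⟨ cong₂ _++_ (filter-all P? Pas) (filter-none P? ¬Pbs) ⟩
    as ++ []                        ≡⟨ ++-identityʳ as ⟩
    as                              ∎
    where open ≡-Reasoning
  drop : ∀ {as bs} → All P as → All (¬_ ∘ P) bs → filter ¬P? (as ++ bs) ≡ bs
  drop {as} {bs} Pas ¬Pbs = begin
    filter ¬P? (as ++ bs)            ≡⟨ filter-++ ¬P? as bs ⟩
    filter ¬P? as ++ filter ¬P? bs   ≡⟨ cong₂ _++_ (filter-none ¬P? (All.map (λ p ¬p → ¬p p) Pas)) (filter-all ¬P? ¬Pbs) ⟩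
    bs                               ∎
    where open ≡-Reasoning

++-cancel-All : ∀ {A : Set} {P : A → Set} {xs ys us vs : List A} →
  All P xs → All P us → All (¬_ ∘ P) ys → All (¬_ ∘ P) vs → xs ++ ys ≡ us ++ vs → xs ≡ us × ys ≡ vs
++-cancel-All [] [] _ _ eq = refl , eq
++-cancel-All [] (Pu ∷ _) (¬Py ∷ _) _ refl = contradiction Pu ¬Py
++-cancel-All [] (_ ∷ _) [] _ ()
++-cancel-All (Px ∷ _) [] _ (¬Pv ∷ _) refl = contradiction Px ¬Pv
++-cancel-All (_ ∷ _) [] _ [] ()
++-cancel-All (_ ∷ Pxs) (_ ∷ Pus) ¬Pys ¬Pvs eq with ∷-injective eq
... | refl , eq′ with ++-cancel-All Pxs Pus ¬Pys ¬Pvs eq′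
...   | refl , ys≡vs = refl , ys≡vs

Linked-++⁻ : ∀ {A : Set} {R : A → A → Set} xs {ys} → Linked R (xs ++ ys) → Linked R xs × Linked R ys
Linked-++⁻ []           l         = [] , l
Linked-++⁻ (x ∷ [])     l         = [-] , Linked.tail l
Linked-++⁻ (x ∷ y ∷ xs) (r ∷ l) with Linked-++⁻ (y ∷ xs) l
... | lxs , lys = r ∷ lxs , lys

-- Union

union-All⁺ : ∀ {P : Part → Set} {X Y} → All P X → All P Y → All P (union X Y)
union-All⁺ {X = X} {Y} PX PY = All-resp-↭ (↭-sym (merge-↭ _ X Y)) (++⁺ PX PY)

union-All⁻ : ∀ {P : Part → Set} X {Y} → All P (union X Y) → All P X × All P Y
union-All⁻ X {Y} PXY = ++⁻ X (All-resp-↭ (merge-↭ _ X Y) PXY)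

union-identityʳ : ∀ X → union X [] ≡ X
union-identityʳ []      = refl
union-identityʳ (_ ∷ _) = refl

union-≤ : ∀ {p q} X Y → minOf p ≤ minOf q → union (p ∷ X) (q ∷ Y) ≡ p ∷ union X (q ∷ Y)
union-≤ {p} {q} _ _ p≤q with minOf p ≤ᵇ minOf q | ≤⇒≤ᵇ p≤q
... | true | _ = refl

union-≰ : ∀ {p q} X Y → ¬ minOf p ≤ minOf q → union (p ∷ X) (q ∷ Y) ≡ q ∷ union (p ∷ X) Y
union-≰ {p} {q} _ _ p≰q with minOf p ≤ᵇ minOf q | ≤ᵇ⇒≤ (minOf p) (minOf q)
... | true  | p≤q = contradiction (p≤q _) p≰q
... | false | _   = refl

union-++ : ∀ {k X₁ Y₁ X₂ Y₂} → MinsAtMost k X₁ → MinsAtMost k Y₁ → MinsAbove k X₂ → MinsAbove k Y₂ →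
  union (X₁ ++ X₂) (Y₁ ++ Y₂) ≡ union X₁ Y₁ ++ union X₂ Y₂
union-++ {X₁ = []} {[]} _ _ _ _ = refl
union-++ {X₁ = []} {y ∷ Y₁} {[]} _ _ _ _ = refl
union-++ {X₁ = []} {y ∷ Y₁} {x ∷ X₂} {Y₂} [] (y≤k ∷ Y₁≤k) (k<x ∷ k<X₂) k<Y₂ =
  trans (union-≰ X₂ (Y₁ ++ Y₂) (λ x≤y → <⇒≱ k<x (≤-trans x≤y y≤k)))
        (cong (y ∷_) (union-++ [] Y₁≤k (k<x ∷ k<X₂) k<Y₂))
union-++ {X₁ = x ∷ X₁} {[]} {X₂} {[]} _ _ _ _ = cong ((x ∷ X₁) ++_) (sym (union-identityʳ X₂))
union-++ {X₁ = x ∷ X₁} {[]} {X₂} {y ∷ Y₂} (x≤k ∷ X₁≤k) [] k<X₂ (k<y ∷ k<Y₂) =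
  trans (union-≤ (X₁ ++ X₂) Y₂ (≤-trans x≤k (<⇒≤ k<y)))
        (cong (x ∷_) (trans (union-++ X₁≤k [] k<X₂ (k<y ∷ k<Y₂))
                            (cong (_++ union X₂ (y ∷ Y₂)) (union-identityʳ X₁))))
union-++ {X₁ = x ∷ X₁} {y ∷ Y₁} {X₂} {Y₂} xX₁≤k@(_ ∷ X₁≤k) yY₁≤k@(_ ∷ Y₁≤k) k<X₂ k<Y₂ =
  [ (λ x≤y → trans (union-≤ (X₁ ++ X₂) (Y₁ ++ Y₂) x≤y)
                   (trans (cong (x ∷_) (union-++ X₁≤k yY₁≤k k<X₂ k<Y₂)) (cong (_++ _) (sym (union-≤ X₁ Y₁ x≤y)))))
  , (λ x≰y → trans (union-≰ (X₁ ++ X₂) (Y₁ ++ Y₂) x≰y)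
                   (trans (cong (y ∷_) (union-++ xX₁≤k Y₁≤k k<X₂ k<Y₂)) (cong (_++ _) (sym (union-≰ X₁ Y₁ x≰y)))))
  ]′ (toSum (minOf x ≤? minOf y))

union-shift : ∀ k {X Y} → MinsAbove 0 X → MinsAbove 0 Y → union (shift k X) (shift k Y) ≡ shift k (union X Y)
union-shift k {[]} _ _ = refl
union-shift k {_ ∷ _} {[]} _ _ = refl
union-shift k {(a ∷ p) ∷ X} {(b ∷ q) ∷ Y} 0<aX@(_ ∷ 0<X) 0<bY@(_ ∷ 0<Y) =
  [ (λ a≤b → begin
  union (shift k ((a ∷ p) ∷ X)) (shift k ((b ∷ q) ∷ Y))  ≡⟨ union-≤ (shift k X) (shift k Y) (+-monoʳ-≤ k a≤b) ⟩
  _ ∷ union (shift k X) (shift k ((b ∷ q) ∷ Y))          ≡⟨ cong (_ ∷_) (union-shift k 0<X 0<bY) ⟩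
  shift k ((a ∷ p) ∷ union X ((b ∷ q) ∷ Y))              ≡⟨ cong (shift k) (union-≤ X Y a≤b) ⟨
  shift k (union ((a ∷ p) ∷ X) ((b ∷ q) ∷ Y))            ∎)
  , (λ a≰b → begin
  union (shift k ((a ∷ p) ∷ X)) (shift k ((b ∷ q) ∷ Y))  ≡⟨ union-≰ (shift k X) (shift k Y) (a≰b ∘ +-cancelˡ-≤ k a b) ⟩
  _ ∷ union (shift k ((a ∷ p) ∷ X)) (shift k Y)          ≡⟨ cong (_ ∷_) (union-shift k 0<aX 0<Y) ⟩
  shift k ((b ∷ q) ∷ union ((a ∷ p) ∷ X) Y)              ≡⟨ cong (shift k) (union-≰ X Y a≰b) ⟨
  shift k (union ((a ∷ p) ∷ X) ((b ∷ q) ∷ Y))            ∎)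
  ]′ (toSum (a ≤? b))
  where open ≡-Reasoning

-- Shifts and concatenation A|B

shift-injective : ∀ k {X Y} → shift k X ≡ shift k Y → X ≡ Y
shift-injective k = map-injective (map-injective (+-cancelˡ-≡ k _ _))

shift-MinsAbove : ∀ k {R} → MinsAbove 0 R → MinsAbove k (shift k R)
shift-MinsAbove k {[]} [] = []
shift-MinsAbove k {(x ∷ p) ∷ R} (0<x ∷ 0<R) = m<m+n k 0<x ∷ shift-MinsAbove k 0<R

bar-identityˡ : ∀ A → bar 0 [] A ≡ A
bar-identityˡ A = trans (map-cong map-id A) (map-id A)

bar-assoc : ∀ k j Q R₁ R₂ → bar k Q (bar j R₁ R₂) ≡ bar (k + j) (bar k Q R₁) R₂
bar-assoc k j Q R₁ R₂ = begin
  Q ++ shift k (R₁ ++ shift j R₂)            ≡⟨ cong (Q ++_) (map-++ (map (k +_)) R₁ _) ⟩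
  Q ++ shift k R₁ ++ shift k (shift j R₂)    ≡⟨ cong (λ X → Q ++ shift k R₁ ++ X) (shift-shift R₂) ⟩
  Q ++ shift k R₁ ++ shift (k + j) R₂        ≡⟨ ++-assoc Q (shift k R₁) _ ⟨
  (Q ++ shift k R₁) ++ shift (k + j) R₂      ∎
  where
  open ≡-Reasoning
  shift-shift : ∀ X → shift k (shift j X) ≡ shift (k + j) X
  shift-shift X = trans (sym (map-∘ X)) (map-cong (λ p → trans (sym (map-∘ p)) (map-cong (λ x → sym (+-assoc k j x)) p)) X)

bar-injective : ∀ {k Q Q′ R R′} → MinsAtMost k Q → MinsAtMost k Q′ → MinsAbove 0 R → MinsAbove 0 R′ →
  bar k Q R ≡ bar k Q′ R′ → Q ≡ Q′ × R ≡ R′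
bar-injective {k} Q≤k Q′≤k 0<R 0<R′ eq =
  Product.map₂ (shift-injective k) (++-cancel-All Q≤k Q′≤k (shifted-above 0<R) (shifted-above 0<R′) eq)
  where
  shifted-above : ∀ {R} → MinsAbove 0 R → All (λ p → ¬ minOf p ≤ k) (shift k R)
  shifted-above 0<R = All.map <⇒≱ (shift-MinsAbove k 0<R)

union-bar : ∀ k {X₁ X₂ Y₁ Y₂} → MinsAtMost k X₁ → MinsAtMost k Y₁ → MinsAbove 0 X₂ → MinsAbove 0 Y₂ →
  union (bar k X₁ X₂) (bar k Y₁ Y₂) ≡ bar k (union X₁ Y₁) (union X₂ Y₂)
union-bar k X₁≤k Y₁≤k 0<X₂ 0<Y₂ =
  trans (union-++ X₁≤k Y₁≤k (shift-MinsAbove k 0<X₂) (shift-MinsAbove k 0<Y₂))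
        (cong (_ ++_) (union-shift k 0<X₂ 0<Y₂))

bar-NoPartCrosses : ∀ {k l Q R} → EntriesIn k Q → EntriesIn l R → NoPartCrosses k (bar k Q R)
bar-NoPartCrosses {k} {l} Q∈ R∈ = ++⁺ (All.map (inj₁ ∘ All.map proj₂) Q∈) (All.map⁺ (All.map shifted-above R∈))
  where
  shifted-above : ∀ {p} → All (InRange l) p → PartBelowOrAbove k (map (k +_) p)
  shifted-above = inj₂ ∘ All.map⁺ ∘ All.map (m<m+n k ∘ proj₁)

NoPartCrosses-shift⁻ : ∀ k {i R} → NoPartCrosses (k + i) (shift k R) → NoPartCrosses i R
NoPartCrosses-shift⁻ k = All.gmap⁻ λ where
  (inj₁ below) → inj₁ (All.gmap⁻ (+-cancelˡ-≤ k _ _) below)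
  (inj₂ above) → inj₂ (All.gmap⁻ (+-cancelˡ-< k _ _) above)

-- Cutting a set partition

IsSetPartition⇒EntriesIn : ∀ {n P} → IsSetPartition n P → EntriesIn n P
IsSetPartition⇒EntriesIn {n} (_ , _ , _ , P↭) = concat⁻ (All-resp-↭ (↭-sym P↭) (range-InRange n))

MinsIn-from-entries : ∀ {n P} → All NonEmpty P → EntriesIn n P → MinsIn n P
MinsIn-from-entries {P = []} [] [] = []
MinsIn-from-entries {P = (x ∷ p) ∷ P} (_ ∷ ne) ((x∈ ∷ _) ∷ P∈) = x∈ ∷ MinsIn-from-entries ne P∈

span-NoPartCrosses : ∀ {i Q} → All NonEmpty Q → Linked _<ᵐ_ Q → NoPartCrosses i Q →
  ∃₂ λ Q₁ Q₂ → Q ≡ Q₁ ++ Q₂ × All (All (_≤ i)) Q₁ × All (All (i <_)) Q₂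
span-NoPartCrosses {Q = []} _ _ _ = [] , [] , refl , [] , []
span-NoPartCrosses {Q = p ∷ Q} (_ ∷ ne) sorted (inj₁ below ∷ cuts) with span-NoPartCrosses ne (Linked.tail sorted) cuts
... | Q₁ , Q₂ , refl , Q₁-below , Q₂-above = p ∷ Q₁ , Q₂ , refl , below ∷ Q₁-below , Q₂-above
span-NoPartCrosses {i} {Q = (x ∷ p) ∷ Q} (_ ∷ ne) sorted (inj₂ above ∷ cuts) =
  [] , _ , refl , [] , above ∷ later-above (AllPairs.head (Linked⇒AllPairs {R = _<ᵐ_} <-trans sorted)) ne cuts
  where
  -- Parts after an above part have larger minima, so they cannot lie below i.
  later-above : ∀ {Q} → All (λ q → x < minOf q) Q → All NonEmpty Q → NoPartCrosses i Q → All (All (i <_)) Q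
  later-above [] [] [] = []
  later-above (_ ∷ x<Q) (_ ∷ ne) (inj₂ q-above ∷ cuts) = q-above ∷ later-above x<Q ne cuts
  later-above {(y ∷ q) ∷ _} (x<y ∷ _) _ (inj₁ (y≤i ∷ _) ∷ _) = contradiction (<-trans (All.head above) x<y) (≤⇒≯ y≤i)

IsPartitionOf-++⁻ : ∀ {i xs ys P₁ P₂} → All (_≤ i) xs → All (i <_) ys → All (All (_≤ i)) P₁ → All (All (i <_)) P₂ →
  IsPartitionOf (xs ++ ys) (P₁ ++ P₂) → IsPartitionOf xs P₁ × IsPartitionOf ys P₂
IsPartitionOf-++⁻ {i} {P₁ = P₁} {P₂} xs≤i i<ys P₁≤i i<P₂ (ne , increasing , sorted , P↭) =
  (ne₁ , inc₁ , sorted₁ , P₁↭) , (ne₂ , inc₂ , sorted₂ , P₂↭)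
  where
  ne₁ = proj₁ (++⁻ P₁ ne)
  ne₂ = proj₂ (++⁻ P₁ ne)
  inc₁ = proj₁ (++⁻ P₁ increasing)
  inc₂ = proj₂ (++⁻ P₁ increasing)
  sorted₁ = proj₁ (Linked-++⁻ P₁ sorted)
  sorted₂ = proj₂ (Linked-++⁻ P₁ sorted)
  splitted = ↭-split (_≤? i) (concat⁺ P₁≤i) (All.map <⇒≱ (concat⁺ i<P₂)) xs≤i (All.map <⇒≱ i<ys)
                     (subst (_↭ _) (sym (concat-++ P₁ P₂)) P↭)
  P₁↭ = proj₁ splitted
  P₂↭ = proj₂ splitted

IsPartitionOf-shift⁻ : ∀ k {xs P} → IsPartitionOf (map (k +_) xs) (shift k P) → IsPartitionOf xs P
IsPartitionOf-shift⁻ k {xs} {P} (ne , increasing , sorted , P↭) =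
  ne′ , All.gmap⁻ (Linked.map (+-cancelˡ-< k _ _) ∘ Linked.map⁻) increasing , sorted′ ne′ sorted , P↭′
  where
  ne′ : All NonEmpty P
  ne′ = All.gmap⁻ (λ {p} → subst (1 ≤_) (length-map (k +_) p)) ne
  sorted′ : ∀ {P} → All NonEmpty P → Linked _<ᵐ_ (shift k P) → Linked _<ᵐ_ P
  sorted′ {[]} _ _ = []
  sorted′ {_ ∷ []} _ _ = [-]
  sorted′ {(x ∷ p) ∷ (y ∷ q) ∷ P} (_ ∷ ne) (k+x<k+y ∷ l) = +-cancelˡ-< k x y k+x<k+y ∷ sorted′ ne l
  unshift-shift : ∀ ys → map (_∸ k) (map (k +_) ys) ≡ ys
  unshift-shift ys = trans (sym (map-∘ ys)) (trans (map-cong (m+n∸m≡n k) ys) (map-id ys))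
  P↭′ : concat P ↭ xs
  P↭′ = subst₂ _↭_ (unshift-shift (concat P)) (unshift-shift xs)
          (↭.map⁺ (_∸ k) (subst (_↭ _) (concat-map P) P↭))

decompose : ∀ i j {Q} → IsSetPartition (i + j) Q → NoPartCrosses i Q →
  ∃₂ λ Q₁ Q₂ → IsSetPartition i Q₁ × IsSetPartition j Q₂ × Q ≡ bar i Q₁ Q₂
decompose i j isP@(ne , _ , sorted , _) cuts with span-NoPartCrosses ne sorted cuts
... | Q₁ , Q₂ , refl , Q₁≤i , i<Q₂ =
  Q₁ , unshift Q₂ , proj₁ parts , IsPartitionOf-shift⁻ i (subst (IsPartitionOf _) (sym shift-unshift) (proj₂ parts)) ,
  cong (Q₁ ++_) (sym shift-unshift)
  where
  unshift : RawPartition → RawPartition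
  unshift = map (map (_∸ i))
  shift-unshift : shift i (unshift Q₂) ≡ Q₂
  shift-unshift = trans (sym (map-∘ Q₂)) (map-id-local (All.map (λ {p} i<p →
    trans (sym (map-∘ p)) (map-id-local (All.map (m+[n∸m]≡n ∘ <⇒≤) i<p))) i<Q₂))
  parts = IsPartitionOf-++⁻ (All.map proj₂ (range-InRange i)) (All.map⁺ (All.map (m<m+n i ∘ proj₁) (range-InRange j)))
            Q₁≤i i<Q₂ (subst (λ xs → IsPartitionOf xs _) (range-+ i j) isP)

Atomic⇒¬NoPartCrosses : ∀ {k i Q} → Atomic k Q → 0 < i → i < k → ¬ NoPartCrosses i Q
Atomic⇒¬NoPartCrosses {k} {i} (isP , _ , indecomposable) 0<i i<k cuts
  with decompose i (k ∸ i) (subst (λ n → IsSetPartition n _) (sym (m+[n∸m]≡n (<⇒≤ i<k))) isP) cuts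
... | Q₁ , Q₂ , isP₁ , isP₂ , Q≡ = indecomposable (i , Q₁ , Q₂ , 0<i , i<k , isP₁ , isP₂ , Q≡)

-- Factorizations

EntriesIn-weaken : ∀ {k n P} → k ≤ n → EntriesIn k P → EntriesIn n P
EntriesIn-weaken k≤n = All.map (All.map (λ (1≤x , x≤k) → 1≤x , ≤-trans x≤k k≤n))

shift-EntriesIn : ∀ k {m R} → EntriesIn m R → EntriesIn (k + m) (shift k R)
shift-EntriesIn k = All.map⁺ ∘ All.map (All.map⁺ ∘ All.map (λ (1≤x , x≤m) → ≤-trans 1≤x (m≤n+m _ k) , +-monoʳ-≤ k x≤m))

Factorization-EntriesIn : ∀ {n A w} → Factorization n A w → EntriesIn n A
Factorization-EntriesIn [] = []
Factorization-EntriesIn (_∷_ {k} {m} (isP , _) f) =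
  ++⁺ (EntriesIn-weaken (m≤m+n k m) (IsSetPartition⇒EntriesIn isP)) (shift-EntriesIn k (Factorization-EntriesIn f))

Factorization-NonEmpty : ∀ {n A w} → Factorization n A w → All NonEmpty A
Factorization-NonEmpty [] = []
Factorization-NonEmpty (_∷_ {k} ((ne , _) , _) f) =
  ++⁺ ne (All.map⁺ (All.map (λ {p} → subst (1 ≤_) (sym (length-map (k +_) p))) (Factorization-NonEmpty f)))

Factorization-MinsIn : ∀ {n A w} → Factorization n A w → MinsIn n A
Factorization-MinsIn f = MinsIn-from-entries (Factorization-NonEmpty f) (Factorization-EntriesIn f)

Factorization-[] : ∀ {n A} → Factorization n A [] → n ≡ 0 × A ≡ []
Factorization-[] [] = refl , refl

Factorization-∷⇒0< : ∀ {n A Q w} → Factorization n A (Q ∷ w) → 0 < n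
Factorization-∷⇒0< (_∷_ {k} {m} (_ , 0<k , _) _) = ≤-trans 0<k (m≤m+n k m)

Factorization-single : ∀ {n A Q} → Factorization n A (Q ∷ []) → A ≡ Q
Factorization-single {Q = Q} (_ ∷ f) with Factorization-[] f
... | refl , refl = ++-identityʳ Q

record Split (i j : ℕ) (A : RawPartition) (w : List RawPartition) : Set where
  constructor split-at
  field
    {A₁ A₂}    : RawPartition
    {w₁ w₂}    : List RawPartition
    factor₁    : Factorization i A₁ w₁
    factor₂    : Factorization j A₂ w₂
    A≡A₁|A₂    : A ≡ bar i A₁ A₂
    w≡w₁++w₂   : w ≡ w₁ ++ w₂

open Split

Split-∷ : ∀ {k i j Q R w} → Atomic k Q → Split i j R w → Split (k + i) j (bar k Q R) (Q ∷ w)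
Split-∷ {k} {i} {Q = Q} atomic (split-at {R₁} {R₂} f₁ f₂ refl refl) = split-at (atomic ∷ f₁) f₂ (bar-assoc k i Q R₁ R₂) refl

split : ∀ {n A w i j} → Factorization n A w → i + j ≡ n → NoPartCrosses i A → Split i j A w
split {A = A} {w} {zero} f refl _ = split-at [] f (sym (bar-identityˡ A)) refl
split {i = suc _} [] () _
split {i = suc i} {j} (_∷_ {k} {m} {Q} {R} {w} atomic f) i+j≡k+m cuts with k ≤? suc i
... | no k≰i = contradiction (++⁻ˡ Q cuts) (Atomic⇒¬NoPartCrosses atomic (s≤s z≤n) (≰⇒> k≰i))
... | yes k≤i with m≤n⇒∃[o]m+o≡n k≤i
...   | i′ , k+i′≡i = subst (λ i → Split i j (bar k Q R) (Q ∷ w)) k+i′≡i (Split-∷ atomic (split f i′+j≡m R-cuts))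
  where
  i′+j≡m : i′ + j ≡ m
  i′+j≡m = +-cancelˡ-≡ k _ _ (trans (sym (+-assoc k i′ j)) (trans (cong (_+ j) k+i′≡i) i+j≡k+m))
  R-cuts : NoPartCrosses i′ R
  R-cuts = NoPartCrosses-shift⁻ k (++⁻ʳ Q (subst (λ i → NoPartCrosses i (bar k Q R)) (sym k+i′≡i) cuts))

-- Relabelling along an order-preserving bijection

relabel-++ˡ : ∀ E F {x} → InRange (length E) x → relabel (E ++ F) x ≡ relabel E x
relabel-++ˡ _       _ {zero}        (() , _)
relabel-++ˡ []      _ {suc _}       (_ , ())
relabel-++ˡ (_ ∷ _) _ {suc zero}    _ = refl
relabel-++ˡ (_ ∷ E) F {suc (suc x)} (_ , s≤s x<E) = relabel-++ˡ E F (s≤s z≤n , x<E)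

relabel-++ʳ : ∀ E F y → relabel (E ++ F) (suc (length E + y)) ≡ relabel F (suc y)
relabel-++ʳ []      F y = refl
relabel-++ʳ (_ ∷ E) F y = relabel-++ʳ E F y

relabel-map : ∀ (f : ℕ → ℕ) E {x} → InRange (length E) x → relabel (map f E) x ≡ f (relabel E x)
relabel-map f _       {zero}        (() , _)
relabel-map f []      {suc _}       (_ , ())
relabel-map f (_ ∷ _) {suc zero}    _ = refl
relabel-map f (_ ∷ E) {suc (suc x)} (_ , s≤s x<E) = relabel-map f E (s≤s z≤n , x<E)

relabel-All : ∀ {P : ℕ → Set} {E x} → All P E → InRange (length E) x → P (relabel E x)
relabel-All {x = zero}        _          (() , _)
relabel-All {x = suc _}       []         (_ , ())
relabel-All {x = suc zero}    (Pe ∷ _)   _ = Pe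
relabel-All {x = suc (suc x)} (_ ∷ PE)   (_ , s≤s x<E) = relabel-All PE (s≤s z≤n , x<E)

map-suc-++-shift : ∀ k E F → map suc (E ++ map (k +_) F) ≡ map suc E ++ map (suc k +_) F
map-suc-++-shift k E F = trans (map-++ suc E _) (cong (map suc E ++_) (sym (map-∘ F)))

elems-++ : ∀ {k l} (S₁ : Subset k) (S₂ : Subset l) → elems (S₁ ++ᵛ S₂) ≡ elems S₁ ++ map (k +_) (elems S₂)
elems-++ []           S₂ = sym (map-id (elems S₂))
elems-++ (true ∷ S₁)  S₂ = cong (1 ∷_) (trans (cong (map suc) (elems-++ S₁ S₂)) (map-suc-++-shift _ (elems S₁) _))
elems-++ (false ∷ S₁) S₂ = trans (cong (map suc) (elems-++ S₁ S₂)) (map-suc-++-shift _ (elems S₁) _)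

length-elems : ∀ {k} (S : Subset k) → length (elems S) ≡ ∣ S ∣
length-elems []          = refl
length-elems (true ∷ S)  = cong suc (trans (length-map suc (elems S)) (length-elems S))
length-elems (false ∷ S) = trans (length-map suc (elems S)) (length-elems S)

elems-InRange : ∀ {k} (S : Subset k) → All (InRange k) (elems S)
elems-InRange []          = []
elems-InRange (true ∷ S)  = (s≤s z≤n , s≤s z≤n) ∷ All.map⁺ (All.map (λ (_ , x≤k) → s≤s z≤n , s≤s x≤k) (elems-InRange S))
elems-InRange (false ∷ S) = All.map⁺ (All.map (λ (_ , x≤k) → s≤s z≤n , s≤s x≤k) (elems-InRange S))

∣p++q∣≡∣p∣+∣q∣ : ∀ {k l} (S₁ : Subset k) (S₂ : Subset l) → ∣ S₁ ++ᵛ S₂ ∣ ≡ ∣ S₁ ∣ + ∣ S₂ ∣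
∣p++q∣≡∣p∣+∣q∣ []           S₂ = refl
∣p++q∣≡∣p∣+∣q∣ (true ∷ S₁)  S₂ = cong suc (∣p++q∣≡∣p∣+∣q∣ S₁ S₂)
∣p++q∣≡∣p∣+∣q∣ (false ∷ S₁) S₂ = ∣p++q∣≡∣p∣+∣q∣ S₁ S₂

∣p∣+∣∁p∣≡n : ∀ {n} (S : Subset n) → ∣ S ∣ + ∣ ∁ S ∣ ≡ n
∣p∣+∣∁p∣≡n S = trans (cong (∣ S ∣ +_) (∣∁p∣≡n∸∣p∣ S)) (m+[n∸m]≡n (∣p∣≤n S))

∁-++ : ∀ {k l} (S₁ : Subset k) (S₂ : Subset l) → ∁ (S₁ ++ᵛ S₂) ≡ ∁ S₁ ++ᵛ ∁ S₂
∁-++ = Vec.map-++ not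

map²-∘ : ∀ {f g : ℕ → ℕ} (A : RawPartition) → map (map (g ∘ f)) A ≡ map (map g) (map (map f) A)
map²-∘ A = trans (map-cong map-∘ A) (map-∘ A)

map²-cong : ∀ {P : ℕ → Set} {f g : ℕ → ℕ} {A} → (∀ {x} → P x → f x ≡ g x) → All (All P) A →
  map (map f) A ≡ map (map g) A
map²-cong f≗g = map-cong-local ∘ All.map (map-cong-local ∘ All.map f≗g)

relabel-elems-InRange : ∀ {k} (S : Subset k) {x} → InRange ∣ S ∣ x → InRange k (relabel (elems S) x)
relabel-elems-InRange S x∈ = relabel-All (elems-InRange S) (subst (λ n → InRange n _) (sym (length-elems S)) x∈)

relabel-elems-++ˡ : ∀ {k l} (S₁ : Subset k) (S₂ : Subset l) {x} → InRange ∣ S₁ ∣ x →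
  relabel (elems (S₁ ++ᵛ S₂)) x ≡ relabel (elems S₁) x
relabel-elems-++ˡ S₁ S₂ x∈ = trans (cong (λ E → relabel E _) (elems-++ S₁ S₂))
  (relabel-++ˡ (elems S₁) _ (subst (λ n → InRange n _) (sym (length-elems S₁)) x∈))

relabel-elems-++ʳ : ∀ {k l} (S₁ : Subset k) (S₂ : Subset l) {y} → suc y ≤ ∣ S₂ ∣ →
  relabel (elems (S₁ ++ᵛ S₂)) (suc (∣ S₁ ∣ + y)) ≡ k + relabel (elems S₂) (suc y)
relabel-elems-++ʳ {k} S₁ S₂ {y} y<S₂ = begin
  relabel (elems (S₁ ++ᵛ S₂)) (suc (∣ S₁ ∣ + y))
    ≡⟨ cong₂ relabel (elems-++ S₁ S₂) (cong (λ n → suc (n + y)) (sym (length-elems S₁))) ⟩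
  relabel (elems S₁ ++ map (k +_) (elems S₂)) (suc (length (elems S₁) + y))
    ≡⟨ relabel-++ʳ (elems S₁) _ y ⟩
  relabel (map (k +_) (elems S₂)) (suc y)
    ≡⟨ relabel-map (k +_) (elems S₂) (s≤s z≤n , subst (suc y ≤_) (sym (length-elems S₂)) y<S₂) ⟩
  k + relabel (elems S₂) (suc y)
    ∎
  where open ≡-Reasoning

lift-MinsIn : ∀ {k A} (S : Subset k) → MinsIn ∣ S ∣ A → MinsIn k (lift A S)
lift-MinsIn {k} S = All.map⁺ ∘ All.map (λ {p} → relabel-min {p})
  where
  relabel-min : ∀ {p} → InRange ∣ S ∣ (minOf p) → InRange k (minOf (map (relabel (elems S)) p))
  relabel-min {[]}    (() , _)
  relabel-min {_ ∷ _} x∈ = relabel-elems-InRange S x∈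

relabel-elems-⊤ : ∀ {k x} → InRange k x → relabel (elems (⊤ {k})) x ≡ x
relabel-elems-⊤ {x = zero} (() , _)
relabel-elems-⊤ {zero} {suc _} (_ , ())
relabel-elems-⊤ {suc k} {suc zero} _ = refl
relabel-elems-⊤ {suc k} {suc (suc x)} (_ , s≤s x<k) =
  trans (relabel-map suc (elems (⊤ {k})) (s≤s z≤n , subst (suc x ≤_) (sym (trans (length-elems (⊤ {k})) (∣⊤∣≡n k))) x<k))
        (cong suc (relabel-elems-⊤ (s≤s z≤n , x<k)))

lift-full : ∀ {k A} (S : Subset k) → ∣ S ∣ ≡ k → EntriesIn k A → lift A S ≡ A
lift-full {A = A} S ∣S∣≡k A∈ =
  trans (cong (lift A) (∣p∣≡n⇒p≡⊤ {p = S} ∣S∣≡k)) (trans (map²-cong relabel-elems-⊤ A∈) (trans (map-cong map-id A) (map-id A)))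

lift-bar : ∀ {k l A₁ A₂} (S₁ : Subset k) (S₂ : Subset l) → EntriesIn ∣ S₁ ∣ A₁ → EntriesIn ∣ S₂ ∣ A₂ →
  lift (bar ∣ S₁ ∣ A₁ A₂) (S₁ ++ᵛ S₂) ≡ bar k (lift A₁ S₁) (lift A₂ S₂)
lift-bar {k} {A₁ = A₁} {A₂} S₁ S₂ A₁∈ A₂∈ =
  trans (map-++ (map ρ) A₁ _)
        (cong₂ _++_ (map²-cong (relabel-elems-++ˡ S₁ S₂) A₁∈)
                    (trans (sym (map²-∘ A₂)) (trans (map²-cong shifted A₂∈) (map²-∘ A₂))))
  where
  ρ = relabel (elems (S₁ ++ᵛ S₂))
  shifted : ∀ {x} → InRange ∣ S₂ ∣ x → ρ (∣ S₁ ∣ + x) ≡ k + relabel (elems S₂) x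
  shifted {zero}  (() , _)
  shifted {suc y} (_ , y<S₂) = trans (cong ρ (+-suc ∣ S₁ ∣ y)) (relabel-elems-++ʳ S₁ S₂ y<S₂)

NoPartCrosses-lift⁻ : ∀ {k l A} (S₁ : Subset k) (S₂ : Subset l) → EntriesIn (∣ S₁ ∣ + ∣ S₂ ∣) A →
  NoPartCrosses k (lift A (S₁ ++ᵛ S₂)) → NoPartCrosses ∣ S₁ ∣ A
NoPartCrosses-lift⁻ {k} S₁ S₂ A∈ cuts = All.zipWith part (A∈ , All.map⁻ cuts)
  where
  ρ = relabel (elems (S₁ ++ᵛ S₂))
  ρ-below : ∀ {x} → InRange ∣ S₁ ∣ x → ρ x ≤ k
  ρ-below x∈ = subst (_≤ k) (sym (relabel-elems-++ˡ S₁ S₂ x∈)) (proj₂ (relabel-elems-InRange S₁ x∈))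
  ρ-above : ∀ {x} → ∣ S₁ ∣ < x → x ≤ ∣ S₁ ∣ + ∣ S₂ ∣ → k < ρ x
  ρ-above S₁<x x≤ with m≤n⇒∃[o]m+o≡n S₁<x
  ... | y , refl = subst (k <_) (sym (relabel-elems-++ʳ S₁ S₂ y<S₂))
                         (m<m+n k (proj₁ (relabel-elems-InRange S₂ (s≤s z≤n , y<S₂))))
    where
    y<S₂ : suc y ≤ ∣ S₂ ∣
    y<S₂ = +-cancelˡ-≤ ∣ S₁ ∣ _ _ (subst (_≤ ∣ S₁ ∣ + ∣ S₂ ∣) (sym (+-suc ∣ S₁ ∣ y)) x≤)
  below⁻ : ∀ {x} → InRange (∣ S₁ ∣ + ∣ S₂ ∣) x → ρ x ≤ k → x ≤ ∣ S₁ ∣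
  below⁻ {x} (_ , x≤) ρx≤k with x ≤? ∣ S₁ ∣
  ... | yes x≤S₁ = x≤S₁
  ... | no x≰S₁  = contradiction ρx≤k (<⇒≱ (ρ-above (≰⇒> x≰S₁) x≤))
  above⁻ : ∀ {x} → InRange (∣ S₁ ∣ + ∣ S₂ ∣) x → k < ρ x → ∣ S₁ ∣ < x
  above⁻ {x} (1≤x , _) k<ρx with x ≤? ∣ S₁ ∣
  ... | yes x≤S₁ = contradiction (ρ-below (1≤x , x≤S₁)) (<⇒≱ k<ρx)
  ... | no x≰S₁  = ≰⇒> x≰S₁
  part : ∀ {p} → All (InRange (∣ S₁ ∣ + ∣ S₂ ∣)) p × PartBelowOrAbove k (map ρ p) → PartBelowOrAbove ∣ S₁ ∣ p
  part (p∈ , inj₁ below) = inj₁ (All.zipWith (λ (x∈ , ρx≤k) → below⁻ x∈ ρx≤k) (p∈ , All.map⁻ below))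
  part (p∈ , inj₂ above) = inj₂ (All.zipWith (λ (x∈ , k<ρx) → above⁻ x∈ k<ρx) (p∈ , All.map⁻ above))

lift-split : ∀ {k l A w} (S₁ : Subset k) (S₂ : Subset l) → Factorization (∣ S₁ ∣ + ∣ S₂ ∣) A w →
  NoPartCrosses k (lift A (S₁ ++ᵛ S₂)) →
  Σ (Split ∣ S₁ ∣ ∣ S₂ ∣ A w) λ s → lift A (S₁ ++ᵛ S₂) ≡ bar k (lift (A₁ s) S₁) (lift (A₂ s) S₂)
lift-split S₁ S₂ f cuts = s , trans (cong (λ A → lift A (S₁ ++ᵛ S₂)) (A≡A₁|A₂ s))
  (lift-bar S₁ S₂ (Factorization-EntriesIn (factor₁ s)) (Factorization-EntriesIn (factor₂ s)))
  where
  s = split f refl (NoPartCrosses-lift⁻ S₁ S₂ (Factorization-EntriesIn f) cuts)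

-- Shuffles

shuffles-[]ʳ : ∀ {X : Set} (u : List X) → shuffles u [] ≡ u ∷ []
shuffles-[]ʳ []      = refl
shuffles-[]ʳ (_ ∷ _) = refl

shuffles-length : ∀ {X : Set} (u v : List X) {w} → w ∈ shuffles u v → length w ≡ length u + length v
shuffles-length []      v       (here refl) = refl
shuffles-length (x ∷ u) []      (here refl) = sym (+-identityʳ _)
shuffles-length (x ∷ u) (y ∷ v) w∈ with ∈-++⁻ (map (x ∷_) (shuffles u (y ∷ v))) w∈
... | inj₁ w∈ˡ with ∈-map⁻ (x ∷_) w∈ˡ
...   | _ , w′∈ , refl = cong suc (shuffles-length u (y ∷ v) w′∈)
shuffles-length (x ∷ u) (y ∷ v) w∈ | inj₂ w∈ʳ with ∈-map⁻ (y ∷_) w∈ʳ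
...   | _ , w′∈ , refl = trans (cong suc (shuffles-length (x ∷ u) v w′∈)) (sym (+-suc (suc (length u)) (length v)))

shuffles-∷ˡ : ∀ {X : Set} x (u v : List X) {w} → w ∈ shuffles u v → x ∷ w ∈ shuffles (x ∷ u) v
shuffles-∷ˡ x u []      w∈ with here refl ← subst (_ ∈_) (shuffles-[]ʳ u) w∈ = here refl
shuffles-∷ˡ x u (y ∷ v) w∈ = ∈-++⁺ˡ (∈-map⁺ (x ∷_) w∈)

shuffles-∷ʳ : ∀ {X : Set} y (u v : List X) {w} → w ∈ shuffles u v → y ∷ w ∈ shuffles u (y ∷ v)
shuffles-∷ʳ y []      v (here refl) = here refl
shuffles-∷ʳ y (x ∷ u) v w∈ = ∈-++⁺ʳ (map (x ∷_) (shuffles u (y ∷ v))) (∈-map⁺ (y ∷_) w∈)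

ShuffleBound : ∀ {X : Set} → List X → List X → List X → Set
ShuffleBound u v w = length w ≤ length u + length v × (length w ≡ length u + length v → w ∈ shuffles u v)

1+r≡s+t⇒s≡1×r≡t : ∀ {r s t} → 0 < s → r ≤ t → suc r ≡ s + t → s ≡ 1 × r ≡ t
1+r≡s+t⇒s≡1×r≡t {r} {s} {t} 0<s r≤t eq = s≡1 , suc-injective (trans eq (cong (_+ t) s≡1))
  where
  s≡1 : s ≡ 1
  s≡1 = ≤-antisym (+-cancelʳ-≤ t s 1 (subst (_≤ suc t) eq (s≤s r≤t))) 0<s

ShuffleBound-∷ : ∀ {X : Set} {q : X} {u₁ u₂ v₁ v₂ w} →
  0 < length u₁ + length v₁ →
  (length u₁ + length v₁ ≡ 1 → (u₁ ≡ q ∷ [] × v₁ ≡ []) ⊎ (u₁ ≡ [] × v₁ ≡ q ∷ [])) →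
  ShuffleBound u₂ v₂ w → ShuffleBound (u₁ ++ u₂) (v₁ ++ v₂) (q ∷ w)
ShuffleBound-∷ {q = q} {u₁} {u₂} {v₁} {v₂} {w} 0<s single (w≤ , tight) =
  subst (suc (length w) ≤_) (sym lengths) (+-mono-≤ 0<s w≤) , tight′
  where
  lengths : length (u₁ ++ u₂) + length (v₁ ++ v₂) ≡ (length u₁ + length v₁) + (length u₂ + length v₂)
  lengths = trans (cong₂ _+_ (length-++ u₁) (length-++ v₁)) (interchange (length u₁) _ _ _)
  tight′ : suc (length w) ≡ length (u₁ ++ u₂) + length (v₁ ++ v₂) → q ∷ w ∈ shuffles (u₁ ++ u₂) (v₁ ++ v₂)
  tight′ eq with 1+r≡s+t⇒s≡1×r≡t 0<s w≤ (trans eq lengths)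
  ... | s≡1 , w≡ with single s≡1
  ...   | inj₁ (refl , refl) = shuffles-∷ˡ q u₂ v₂ (tight w≡)
  ...   | inj₂ (refl , refl) = shuffles-∷ʳ q u₂ v₂ (tight w≡)

-- Factorizations of a lifted union

first-factors-nonempty : ∀ {i j A B wA wB} → Factorization i A wA → Factorization j B wB → 0 < i + j →
  0 < length wA + length wB
first-factors-nonempty {wA = _ ∷ _} _ _ _ = s≤s z≤n
first-factors-nonempty {wA = []} {_ ∷ _} _ _ _ = s≤s z≤n
first-factors-nonempty {wA = []} {[]} fA fB 0<i+j with Factorization-[] fA | Factorization-[] fB
... | refl , _ | refl , _ = contradiction 0<i+j λ ()

single-first-factor : ∀ {k Q A B wA wB} (S : Subset k) → Factorization ∣ S ∣ A wA → Factorization ∣ ∁ S ∣ B wB →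
  Q ≡ union (lift A S) (lift B (∁ S)) → length wA + length wB ≡ 1 →
  (wA ≡ Q ∷ [] × wB ≡ []) ⊎ (wA ≡ [] × wB ≡ Q ∷ [])
single-first-factor {wA = _ ∷ []} {[]} S fA fB Q≡ _ with Factorization-[] fB
... | ∣∁S∣≡0 , refl = inj₁ (cong (_∷ []) (sym (trans Q≡ (trans (union-identityʳ _) lift-A≡A))) , refl)
  where
  ∣S∣≡k = trans (sym (+-identityʳ ∣ S ∣)) (trans (cong (∣ S ∣ +_) (sym ∣∁S∣≡0)) (∣p∣+∣∁p∣≡n S))
  lift-A≡A = trans (lift-full S ∣S∣≡k (subst (λ n → EntriesIn n _) ∣S∣≡k (Factorization-EntriesIn fA)))
                   (Factorization-single fA)
single-first-factor {wA = []} {_ ∷ []} S fA fB Q≡ _ with Factorization-[] fA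
... | ∣S∣≡0 , refl = inj₂ (refl , cong (_∷ []) (sym (trans Q≡ lift-B≡B)))
  where
  ∣∁S∣≡k = trans (cong (_+ ∣ ∁ S ∣) (sym ∣S∣≡0)) (∣p∣+∣∁p∣≡n S)
  lift-B≡B = trans (lift-full (∁ S) ∣∁S∣≡k (subst (λ n → EntriesIn n _) ∣∁S∣≡k (Factorization-EntriesIn fB)))
                   (Factorization-single fB)
single-first-factor {wA = []}          {[]}        _ _ _ _ ()
single-first-factor {wA = []}          {_ ∷ _ ∷ _} _ _ _ _ ()
single-first-factor {wA = _ ∷ []}      {_ ∷ _}     _ _ _ _ ()
single-first-factor {wA = _ ∷ _ ∷ _}   {_}         _ _ _ _ ()

union-lift-∷ : ∀ {k N Q R wR A B wA wB} → Atomic k Q → Factorization N R wR → (S₁ : Subset k) (S₂ : Subset N) →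
  Factorization ∣ S₁ ++ᵛ S₂ ∣ A wA → Factorization ∣ ∁ (S₁ ++ᵛ S₂) ∣ B wB →
  bar k Q R ≡ union (lift A (S₁ ++ᵛ S₂)) (lift B (∁ (S₁ ++ᵛ S₂))) →
  Σ (Split ∣ S₁ ∣ ∣ S₂ ∣ A wA) λ sA → Σ (Split ∣ ∁ S₁ ∣ ∣ ∁ S₂ ∣ B wB) λ sB →
    Q ≡ union (lift (A₁ sA) S₁) (lift (A₁ sB) (∁ S₁)) × R ≡ union (lift (A₂ sA) S₂) (lift (A₂ sB) (∁ S₂))
union-lift-∷ {k} {Q = Q} {R} {A = A} {B} {wA} {wB} (isQ , _) fR S₁ S₂ fA fB C≡ =
  sA , sB , bar-injective (atMost Q-mins) (union-All⁺ (atMost X₁-mins) (atMost Y₁-mins))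
                          (positive R-mins) (union-All⁺ (positive X₂-mins) (positive Y₂-mins)) C≡′
  where
  atMost = MinsIn⇒MinsAtMost
  positive = MinsIn⇒MinsAbove0
  ∁S≡ : ∁ (S₁ ++ᵛ S₂) ≡ ∁ S₁ ++ᵛ ∁ S₂
  ∁S≡ = ∁-++ S₁ S₂
  C≡₁ : bar k Q R ≡ union (lift A (S₁ ++ᵛ S₂)) (lift B (∁ S₁ ++ᵛ ∁ S₂))
  C≡₁ = trans C≡ (cong (λ T → union (lift A (S₁ ++ᵛ S₂)) (lift B T)) ∁S≡)
  cuts : NoPartCrosses k (lift A (S₁ ++ᵛ S₂)) × NoPartCrosses k (lift B (∁ S₁ ++ᵛ ∁ S₂))
  cuts = union-All⁻ (lift A (S₁ ++ᵛ S₂))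
           (subst (NoPartCrosses k) C≡₁ (bar-NoPartCrosses (IsSetPartition⇒EntriesIn isQ) (Factorization-EntriesIn fR)))
  A-split = lift-split S₁ S₂ (subst (λ n → Factorization n A wA) (∣p++q∣≡∣p∣+∣q∣ S₁ S₂) fA) (proj₁ cuts)
  B-split = lift-split (∁ S₁) (∁ S₂)
              (subst (λ n → Factorization n B wB) (trans (cong ∣_∣ ∁S≡) (∣p++q∣≡∣p∣+∣q∣ (∁ S₁) (∁ S₂))) fB) (proj₂ cuts)
  sA = proj₁ A-split
  sB = proj₁ B-split
  X₁ = lift (A₁ sA) S₁
  X₂ = lift (A₂ sA) S₂
  Y₁ = lift (A₁ sB) (∁ S₁)
  Y₂ = lift (A₂ sB) (∁ S₂)
  Q-mins = MinsIn-from-entries (proj₁ isQ) (IsSetPartition⇒EntriesIn isQ)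
  R-mins = Factorization-MinsIn fR
  X₁-mins = lift-MinsIn S₁ (Factorization-MinsIn (factor₁ sA))
  X₂-mins = lift-MinsIn S₂ (Factorization-MinsIn (factor₂ sA))
  Y₁-mins = lift-MinsIn (∁ S₁) (Factorization-MinsIn (factor₁ sB))
  Y₂-mins = lift-MinsIn (∁ S₂) (Factorization-MinsIn (factor₂ sB))
  C≡′ : bar k Q R ≡ bar k (union X₁ Y₁) (union X₂ Y₂)
  C≡′ = begin
    bar k Q R                                           ≡⟨ C≡₁ ⟩
    union (lift A (S₁ ++ᵛ S₂)) (lift B (∁ S₁ ++ᵛ ∁ S₂)) ≡⟨ cong₂ union (proj₂ A-split) (proj₂ B-split) ⟩
    union (bar k X₁ X₂) (bar k Y₁ Y₂)                   ≡⟨ union-bar k (atMost X₁-mins) (atMost Y₁-mins)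
                                                                       (positive X₂-mins) (positive Y₂-mins) ⟩
    bar k (union X₁ Y₁) (union X₂ Y₂)                   ∎
    where open ≡-Reasoning

union-lift-bound : ∀ {N C wC A B wA wB} → Factorization N C wC → (S : Subset N) →
  Factorization ∣ S ∣ A wA → Factorization ∣ ∁ S ∣ B wB → C ≡ union (lift A S) (lift B (∁ S)) → ShuffleBound wA wB wC
union-lift-bound {wA = []}    {[]}    [] [] _  _  _ = z≤n , λ _ → here refl
union-lift-bound {wA = _ ∷ _}         [] [] fA _  _ = contradiction (Factorization-∷⇒0< fA) λ ()
union-lift-bound {wA = []}    {_ ∷ _} [] [] _  fB _ = contradiction (Factorization-∷⇒0< fB) λ ()
union-lift-bound (_∷_ {k} atomic fR) S fA fB C≡ with splitAt k S
... | S₁ , S₂ , refl with union-lift-∷ atomic fR S₁ S₂ fA fB C≡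
...   | split-at fA₁ fA₂ refl refl , split-at fB₁ fB₂ refl refl , Q≡ , R≡ =
  ShuffleBound-∷ (first-factors-nonempty fA₁ fB₁ (subst (0 <_) (sym (∣p∣+∣∁p∣≡n S₁)) (proj₁ (proj₂ atomic))))
                 (single-first-factor S₁ fA₁ fB₁ Q≡)
                 (union-lift-bound fR S₂ fA₂ fB₂ R≡)

mainTheorem8 : (n m : ℕ) (A B : RawPartition) →
    IsSetPartition n A → IsSetPartition m B →
    (S : Subset (n + m)) → ∣ S ∣ ≡ n →
    (wA wB wC : List RawPartition) →
    Factorization n A wA → Factorization m B wB →
    Factorization (n + m) (union (lift A S) (lift B (∁ S))) wC →
    (length wC ≤ length wA + length wB) ×
    ((length wC ≡ length wA + length wB) ⇔ (wC ∈ shuffles wA wB))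
-- The set-partition hypotheses on A and B are implied by their factorizations.
mainTheorem8 n m A B _ _ S ∣S∣≡n wA wB wC fA fB fC = proj₁ bound , mk⇔ (proj₂ bound) (shuffles-length wA wB)
  where
  ∣∁S∣≡m : ∣ ∁ S ∣ ≡ m
  ∣∁S∣≡m = +-cancelˡ-≡ n _ _ (trans (cong (_+ ∣ ∁ S ∣) (sym ∣S∣≡n)) (∣p∣+∣∁p∣≡n S))
  bound : ShuffleBound wA wB wC
  bound = union-lift-bound fC S (subst (λ i → Factorization i A wA) (sym ∣S∣≡n) fA)
                                (subst (λ j → Factorization j B wB) (sym ∣∁S∣≡m) fB) refl
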